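{- Let $G=(V,E)$ be a cocomparability graph with $|V|=n$ and let $\sigma=(u_1,u_2,\dots,u_n,u_{n+1})$ be an LDFS umbrella-free ordering of $V\cup\{u_{n+1}\}$, where $u_{n+1}$ is a dummy isolated vertex. Suppose that $u_i<_\sigma u_x$ and $u_x\in N(u_i)$. Then $u_k\in N(u_i)$ for every $u_k\in V(G(i+1,x-1))$.
   Context: Graphs are finite, simple, undirected; $N(v)$ is the neighborhood of $v$. An ordering $\sigma$ is umbrella-free if for all $x<_\sigma y<_\sigma z$, $xz\in E$ implies $xy\in E$ or $yz\in E$. For an ordering $\sigma$, a triple $(a,b,c)$ with $a<_\sigma b<_\sigma c$, $ac\in E$, $ab\notin E$ is good if there is a vertex $d$ with $a<_\sigma d<_\sigma b$, $db\in E$, $dc\notin E$, and bad otherwise; $\sigma$ is an LDFS ordering if it has no bad triple. The vertices are indexed by their position in $\sigma$, and $u_{n+1}$ (the rightmost vertex) is adjacent to no vertex. For indices $i,j$: if $i>j$ then $G(i,j)$ is the empty graph; if $i\le j$ then $G(i,j)$ is the subgraph of $G$ induced by $\{u_i,u_{i+1},\dots,u_j\}\setminus N(u_{j+1})$. -}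

module Defs where

open import Data.Nat using (ℕ; suc; _≤_)
open import Data.Fin using (Fin; toℕ; inject₁; fromℕ) renaming (_<_ to _<ᶠ_)
open import Data.Product using (Σ; _×_; ∃)
open import Data.Sum using (_⊎_)
open import Relation.Nullary using (¬_)
open import Relation.Binary.PropositionalEquality using (_≡_)
open import Data.Empty using (⊥)

record SimpleGraph (V : Set) : Set₁ where
  field
    Adj     : V → V → Set
    sym     : ∀ {u v} → Adj u v → Adj v u
    irrefl  : ∀ {u} → ¬ Adj u u
open SimpleGraph public

record TransOrientComplement {V : Set} (G : SimpleGraph V) : Set₁ where
  field
    O          : V → V → Set
    O-nonedge  : ∀ {u v} → O u v → (¬ (u ≡ v) × ¬ Adj G u v)
    O-total    : ∀ {u v} → ¬ (u ≡ v) → ¬ Adj G u v → O u v ⊎ O v u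
    O-asym     : ∀ {u v} → O u v → ¬ O v u
    O-trans    : ∀ {u v w} → O u v → O v w → O u w

IsCocomparability : {V : Set} → SimpleGraph V → Set₁
IsCocomparability G = TransOrientComplement G

-- Graphs whose vertices are the positions 0..n of an ordering σ (position p is u_{p+1}).
-- The ordering σ is thus the natural order on Fin (suc n).

-- The induced subgraph of G on the first n positions (the real vertex set V).
restrict : ∀ {n} → SimpleGraph (Fin (suc n)) → SimpleGraph (Fin n)
restrict G = record
  { Adj    = λ u v → Adj G (inject₁ u) (inject₁ v)
  ; sym    = sym G
  ; irrefl = irrefl G }

UmbrellaFree : ∀ {m} → SimpleGraph (Fin m) → Set
UmbrellaFree G = ∀ x y z → x <ᶠ y → y <ᶠ z → Adj G x z → Adj G x y ⊎ Adj G y z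

LDFS : ∀ {m} → SimpleGraph (Fin m) → Set
LDFS G = ∀ a b c → a <ᶠ b → b <ᶠ c → Adj G a c → ¬ Adj G a b →
         ∃ λ d → a <ᶠ d × d <ᶠ b × Adj G d b × ¬ Adj G d c

-- Vertex set of G(a,b) (0-based positions a,b):
-- { positions k : a ≤ k ≤ b } minus N(position b+1).
-- (When a > b this is empty automatically.)
InSub : ∀ {m} → SimpleGraph (Fin m) → ℕ → ℕ → Fin m → Set
InSub G a b k = a ≤ toℕ k × toℕ k ≤ b × (∀ w → toℕ w ≡ suc b → ¬ Adj G k w)

module Submission where

open import Defs
open import Data.Nat using (ℕ; suc; _∸_; _<_; z≤n; NonZero; >-nonZero)
open import Data.Nat.Properties using (m≤pred[n]⇒suc[m]≤n; suc-pred; ≤-<-trans)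
open import Data.Fin using (Fin; toℕ; fromℕ) renaming (_<_ to _<ᶠ_)
open import Data.Sum using (inj₁; inj₂)
open import Data.Empty using (⊥-elim)
open import Data.Product using (_,_)
open import Relation.Nullary using (¬_)
open import Relation.Binary.PropositionalEquality using () renaming (sym to ≡-sym)

-- Only umbrella-freeness is used: x is the vertex right after the window G(i+1, x-1),
-- whose vertices therefore lie strictly between i and x and miss x.

umbrella-free⇒adj-left : ∀ {m} {G : SimpleGraph (Fin m)} {i k x} → UmbrellaFree G →
                         i <ᶠ k → k <ᶠ x → Adj G i x → ¬ Adj G k x →
                         Adj G i k
umbrella-free⇒adj-left {i = i} {k} {x} uf i<k k<x ix k≁x with uf i k x i<k k<x ix
... | inj₁ ik = ik
... | inj₂ kx = ⊥-elim (k≁x kx)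

lemma9 : (n : ℕ) (G : SimpleGraph (Fin (suc n))) →
         IsCocomparability (restrict G) →
         (∀ v → ¬ Adj G (fromℕ n) v) →
         UmbrellaFree G → LDFS G →
         (i x : Fin (suc n)) → i <ᶠ x → Adj G i x →
         ∀ k → InSub G (suc (toℕ i)) (toℕ x ∸ 1) k → Adj G i k
lemma9 n G _ _ uf _ i x i<x ix k (i<k , k≤x-1 , k≁next) =
  umbrella-free⇒adj-left {G = G} uf i<k k<x ix (k≁next x (≡-sym (suc-pred (toℕ x))))
  where
  instance
    x≢0 : NonZero (toℕ x)
    x≢0 = >-nonZero (≤-<-trans z≤n i<x)
  k<x : toℕ k < toℕ x
  k<x = m≤pred[n]⇒suc[m]≤n k≤x-1
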